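{- Let $h$ be a Hessenberg function with degree tuple $\beta=(\beta_n,\ldots,\beta_1)$. With respect to the lexicographic order, the ideal $\langle LT(J_h)\rangle$ generated by the leading terms of all elements of $J_h$ equals the monomial ideal $\langle x_1^{\beta_1},x_2^{\beta_2},\ldots,x_n^{\beta_n}\rangle$.
   Context: A Hessenberg function is an $n$-tuple $h=(h_1,\ldots,h_n)$ of integers with $i\le h_i\le n$ and $h_i\le h_{i+1}$. Its degree tuple is $\beta=(\beta_n,\ldots,\beta_1)$ with $\beta_i=i-\#\{k:h_k<i\}$. For $S\subseteq\{1,\ldots,n\}$, $\tilde e_d(S)$ is the sum of all monomials of degree $d$ in $x_i$, $i\in S$, and $\tilde e_d(i,\ldots,n)$ means $S=\{i,\ldots,n\}$. $J_h$ is the ideal of $\mathbb{Z}[x_1,\ldots,x_n]$ generated by $\tilde e_{\beta_i}(i,\ldots,n)$, $i=1,\ldots,n$. Lexicographic order: $x^\alpha>x^\gamma$ if the leftmost nonzero entry of $\alpha-\gamma$ is positive. -}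

module Defs where

open import Data.Nat as ℕ using (ℕ; zero; suc; _≤_; _<_; _<?_; _≤ᵇ_)
open import Data.Integer as ℤ using (ℤ; 0ℤ; 1ℤ)
open import Data.Fin using (Fin; toℕ)
open import Data.Fin.Subset using (Subset)
open import Data.Bool using (Bool; true; false)
open import Data.Vec as Vec using (Vec; []; _∷_; zipWith; tabulate; replicate; _[_]≔_)
open import Data.Vec.Properties using (≡-dec)
open import Data.List as List using (List; []; _∷_; [_]; map; concatMap; concat; filter; length; allFin; upTo)
open import Data.List.Relation.Unary.All using (All)
open import Data.Product using (Σ; _×_; _,_; proj₁; proj₂)
open import Relation.Binary.PropositionalEquality using (_≡_; _≢_)
open import Relation.Nullary using (yes; no)

-- Monomials and polynomials in ℤ[x₁,…,xₙ]
-- A monomial x^α is its exponent vector α : Vec ℕ n (position 0 = x₁).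
-- A polynomial is a finite formal sum of terms c·x^α (a list);
-- its actual value is given by its coefficient function `coeff`.

Mono : ℕ → Set
Mono n = Vec ℕ n

Poly : ℕ → Set
Poly n = List (ℤ × Mono n)

coeff : ∀ {n} → Poly n → Mono n → ℤ
coeff [] α = 0ℤ
coeff ((c , γ) ∷ p) α with ≡-dec ℕ._≟_ γ α
... | yes _ = c ℤ.+ coeff p α
... | no  _ = coeff p α

_≈_ : ∀ {n} → Poly n → Poly n → Set
p ≈ q = ∀ α → coeff p α ≡ coeff q α

_+P_ : ∀ {n} → Poly n → Poly n → Poly n
p +P q = p List.++ q

_*P_ : ∀ {n} → Poly n → Poly n → Poly n
p *P q = concatMap (λ t → map (λ s → (proj₁ t ℤ.* proj₁ s , zipWith ℕ._+_ (proj₂ t) (proj₂ s))) q) p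

sumP : ∀ {n} → List (Poly n) → Poly n
sumP = concat

term : ∀ {n} → ℤ → Mono n → Poly n
term c α = [ (c , α) ]

-- x_i^b  (i : Fin n is the 0-based index of variable x_{i+1})
xpow : ∀ {n} → Fin n → ℕ → Poly n
xpow {n} i b = term 1ℤ (replicate n 0 [ i ]≔ b)

Gen : ∀ {n} → (Poly n → Set) → Poly n → Set
Gen {n} P f = Σ (List (Poly n × Poly n)) λ cs →
  All (λ c → P (proj₂ c)) cs × (f ≈ sumP (map (λ c → proj₁ c *P proj₂ c) cs))

data _>lex_ : ∀ {n} → Mono n → Mono n → Set where
  here  : ∀ {n a b} {α γ : Mono n} → b < a → (a ∷ α) >lex (b ∷ γ)
  there : ∀ {n a} {α γ : Mono n} → α >lex γ → (a ∷ α) >lex (a ∷ γ)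

IsLeadingTerm : ∀ {n} → Poly n → ℤ → Mono n → Set
IsLeadingTerm g c α = (coeff g α ≡ c) × (c ≢ 0ℤ) × (∀ γ → γ >lex α → coeff g γ ≡ 0ℤ)

LTIdeal : ∀ {n} → (Poly n → Set) → Poly n → Set
LTIdeal {n} I = Gen (λ t → Σ (Poly n) λ g → I g × Σ ℤ λ c → Σ (Mono n) λ α →
                    IsLeadingTerm g c α × (t ≡ term c α))

-- all exponent vectors of total degree d supported on S (each exactly once)
monos : ∀ n → Subset n → ℕ → List (Mono n)
monos zero [] zero = [ [] ]
monos zero [] (suc d) = []
monos (suc n) (false ∷ S) d = map (0 ∷_) (monos n S d)
monos (suc n) (true ∷ S) d = concatMap (λ k → map (k ∷_) (monos n S (d ℕ.∸ k))) (upTo (suc d))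

eTilde : ∀ {n} → ℕ → Subset n → Poly n
eTilde {n} d S = map (λ α → (1ℤ , α)) (monos n S d)

-- the set {i,…,n} (i : Fin n 0-based, i.e. variables x_{i+1},…,x_n)
from : ∀ {n} → Fin n → Subset n
from i = tabulate (λ j → toℕ i ≤ᵇ toℕ j)

-- Hessenberg functions (0-based: h i is h_{i+1})

IsHessenberg : ∀ n → (Fin n → ℕ) → Set
IsHessenberg n h =
  (∀ i → (suc (toℕ i) ≤ h i) × (h i ≤ n)) ×
  (∀ (i j : Fin n) → toℕ j ≡ suc (toℕ i) → h i ≤ h j)

beta : ∀ {n} → (Fin n → ℕ) → Fin n → ℕ
beta {n} h i = suc (toℕ i) ℕ.∸ length (filter (λ k → h k <? suc (toℕ i)) (allFin n))

Jh : ∀ {n} → (Fin n → ℕ) → Poly n → Set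
Jh h = Gen (λ g → Σ _ λ i → g ≡ eTilde (beta h i) (from i))

MonIdealBeta : ∀ {n} → (Fin n → ℕ) → Poly n → Set
MonIdealBeta h = Gen (λ g → Σ _ λ i → g ≡ xpow i (beta h i))

-- The generators g_i = ẽ_{β_i}(x_i,…,x_n) have leading term x_i^{β_i} with coefficient 1, which gives
-- one inclusion. For the other, the leading exponent α of any nonzero p ∈ J_h has β_i ≤ α_i for some
-- i; this is proved by induction on n for arbitrary β. Only g₁ involves x₁, so p = Q·g₁ + R with all
-- x₁-coefficients of R in J′ = ⟨g₂,…,g_n⟩ ⊆ ℤ[x₂,…,x_n]. Suppose α₁ < β₁. Then the x₁-coefficients of
-- p above α₁ vanish, and since g₁ = Σ_{k ≤ β₁} x₁^k·ẽ_{β₁−k}(x₂,…,x_n) is monic of degree β₁ in x₁,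
-- comparing coefficients of x₁^{a+β₁} puts every x₁-coefficient of Q into J′, by downward induction
-- on a. Hence the x₁^{α₁}-coefficient of p lies in J′, and its leading exponent is (α₂,…,α_n).

module Submission where

open import Defs
open import Data.Nat using (ℕ)
open import Data.Fin using (Fin)
open import Data.Product using (_×_)

open import Algebra.Bundles using (CommutativeMonoid)
open import Data.Bool using (Bool; true; false; if_then_else_; _∧_)
open import Data.Bool.Properties using (∧-commutativeMonoid)
open import Algebra.Properties.CommutativeSemigroup
  (CommutativeMonoid.commutativeSemigroup ∧-commutativeMonoid) using (interchange)
open import Data.Empty using (⊥-elim)
open import Data.Fin using (toℕ) renaming (zero to fzero; suc to fsuc)
open import Data.Fin.Subset using (Subset)
open import Data.Integer using (ℤ; 0ℤ; 1ℤ; _+_; _-_; _*_; -_)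
import Data.Integer.Properties as ℤₚ
open import Data.Integer.Tactic.RingSolver using (solve-∀)
open import Data.List using (List; []; _∷_; [_]; _++_; map; concatMap; upTo; _∷ʳ_)
import Data.List.Properties as Listₚ
open import Data.List.Relation.Unary.All using (All; []; _∷_)
import Data.List.Relation.Unary.All.Properties as All
open import Data.Nat as ℕ using (zero; suc; _≤_; _<_; z≤n; s≤s)
import Data.Nat.Properties as ℕₚ
open import Data.Product as Product using (Σ; _,_; proj₁; proj₂; ∃)
open import Data.Vec as Vec using ([]; _∷_; zipWith; replicate; lookup; _[_]≔_; tabulate)
open import Data.Vec.Properties using (≡-dec; ∷-injectiveˡ; ∷-injectiveʳ; tabulate-cong)
import Data.Vec.Relation.Binary.Pointwise.Inductive as Pointwise
open import Function using (id; _∘′_)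
open import Relation.Binary.Definitions using (Tri; tri<; tri≈; tri>)
open import Relation.Binary.PropositionalEquality
  using (_≡_; _≢_; refl; sym; trans; cong; cong₂; subst; module ≡-Reasoning)
open import Relation.Nullary using (Dec; yes; no)

private
  variable
    n : ℕ

-- Structural version of ℕ._≤ᵇ_: it computes on suc/suc arguments.
leb : ℕ → ℕ → Bool
leb zero    _       = true
leb (suc _) zero    = false
leb (suc m) (suc n) = leb m n

≤⇒leb : ∀ {m n} → m ≤ n → leb m n ≡ true
≤⇒leb z≤n     = refl
≤⇒leb (s≤s p) = ≤⇒leb p

>⇒leb : ∀ {m n} → n < m → leb m n ≡ false
>⇒leb {suc m} {zero}  _       = refl
>⇒leb {suc m} {suc n} (s≤s p) = >⇒leb p

leb⇒m+[n∸m]≡n : ∀ m n → leb m n ≡ true → m ℕ.+ (n ℕ.∸ m) ≡ n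
leb⇒m+[n∸m]≡n zero    n       _ = refl
leb⇒m+[n∸m]≡n (suc m) (suc n) e = cong suc (leb⇒m+[n∸m]≡n m n e)

leb-+ : ∀ m n a → leb (m ℕ.+ n) a ≡ leb m a ∧ leb n (a ℕ.∸ m)
leb-+ zero    n a       = refl
leb-+ (suc m) n zero    = refl
leb-+ (suc m) n (suc a) = leb-+ m n a

infixl 6 _+ᵐ_ _∸ᵐ_
infix 5 _∣ᵇ_

_+ᵐ_ : Mono n → Mono n → Mono n
_+ᵐ_ = zipWith ℕ._+_

_∸ᵐ_ : Mono n → Mono n → Mono n
_∸ᵐ_ = zipWith ℕ._∸_

𝟎 : Mono n
𝟎 = replicate _ 0

_∣ᵇ_ : Mono n → Mono n → Bool
[]      ∣ᵇ []      = true
(g ∷ γ) ∣ᵇ (a ∷ α) = leb g a ∧ (γ ∣ᵇ α)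

+ᵐ-comm : (γ δ : Mono n) → γ +ᵐ δ ≡ δ +ᵐ γ
+ᵐ-comm γ δ = Pointwise.Pointwise-≡⇒≡
  (Pointwise.zipWith-comm {_∼_ = _≡_} {f = ℕ._+_} ℕₚ.+-comm γ δ)

+ᵐ-assoc : (γ δ ε : Mono n) → (γ +ᵐ δ) +ᵐ ε ≡ γ +ᵐ (δ +ᵐ ε)
+ᵐ-assoc γ δ ε = Pointwise.Pointwise-≡⇒≡
  (Pointwise.zipWith-assoc {_∼_ = _≡_} {f = ℕ._+_} ℕₚ.+-assoc γ δ ε)

+ᵐ-identityˡ : (γ : Mono n) → 𝟎 +ᵐ γ ≡ γ
+ᵐ-identityˡ γ = Pointwise.Pointwise-≡⇒≡
  (Pointwise.zipWith-identityˡ {_∼_ = _≡_} {f = ℕ._+_} ℕₚ.+-identityˡ γ)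

+ᵐ-identityʳ : (γ : Mono n) → γ +ᵐ 𝟎 ≡ γ
+ᵐ-identityʳ γ = Pointwise.Pointwise-≡⇒≡
  (Pointwise.zipWith-identityʳ {_∼_ = _≡_} {f = ℕ._+_} ℕₚ.+-identityʳ γ)

∸ᵐ-identityʳ : (α : Mono n) → α ∸ᵐ 𝟎 ≡ α
∸ᵐ-identityʳ α = Pointwise.Pointwise-≡⇒≡
  (Pointwise.zipWith-identityʳ {_∼_ = _≡_} {f = ℕ._∸_} (λ _ → refl) α)

+ᵐ-∸ᵐ : (γ δ : Mono n) → (γ +ᵐ δ) ∸ᵐ γ ≡ δ
+ᵐ-∸ᵐ []      []      = refl
+ᵐ-∸ᵐ (g ∷ γ) (d ∷ δ) = cong₂ _∷_ (ℕₚ.m+n∸m≡n g d) (+ᵐ-∸ᵐ γ δ)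

∸ᵐ-∸ᵐ : (α γ δ : Mono n) → (α ∸ᵐ γ) ∸ᵐ δ ≡ α ∸ᵐ (γ +ᵐ δ)
∸ᵐ-∸ᵐ []      []      []      = refl
∸ᵐ-∸ᵐ (a ∷ α) (g ∷ γ) (d ∷ δ) = cong₂ _∷_ (ℕₚ.∸-+-assoc a g d) (∸ᵐ-∸ᵐ α γ δ)

𝟎-∣ᵇ : (α : Mono n) → 𝟎 ∣ᵇ α ≡ true
𝟎-∣ᵇ []      = refl
𝟎-∣ᵇ (a ∷ α) = 𝟎-∣ᵇ α

∣ᵇ-+ᵐ : (γ δ : Mono n) → γ ∣ᵇ γ +ᵐ δ ≡ true
∣ᵇ-+ᵐ []      []      = refl
∣ᵇ-+ᵐ (g ∷ γ) (d ∷ δ) rewrite ≤⇒leb (ℕₚ.m≤m+n g d) = ∣ᵇ-+ᵐ γ δ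

∣ᵇ-split : (γ δ α : Mono n) → γ +ᵐ δ ∣ᵇ α ≡ (γ ∣ᵇ α) ∧ (δ ∣ᵇ α ∸ᵐ γ)
∣ᵇ-split []      []      []      = refl
∣ᵇ-split (g ∷ γ) (d ∷ δ) (a ∷ α) rewrite leb-+ g d a | ∣ᵇ-split γ δ α =
  interchange (leb g a) (leb d (a ℕ.∸ g)) (γ ∣ᵇ α) (δ ∣ᵇ α ∸ᵐ γ)

∣ᵇ⇒+ᵐ∸ᵐ : (γ α : Mono n) → γ ∣ᵇ α ≡ true → γ +ᵐ (α ∸ᵐ γ) ≡ α
∣ᵇ⇒+ᵐ∸ᵐ []      []      _ = refl
∣ᵇ⇒+ᵐ∸ᵐ (g ∷ γ) (a ∷ α) e with leb g a in g≤a
... | true = cong₂ _∷_ (leb⇒m+[n∸m]≡n g a g≤a) (∣ᵇ⇒+ᵐ∸ᵐ γ α e)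

-- Polynomials are handled through their coefficient functions: mulTerm c γ and _⊙ L multiply by c·x^γ
-- and by L, and the ideal is generated on coefficient functions (InJ), so that the x₁-coefficients
-- of a polynomial are restrictions (slice).
Coeffs : ℕ → Set
Coeffs n = Mono n → ℤ

infix 4 _≐_
_≐_ : Coeffs n → Coeffs n → Set
F ≐ G = ∀ α → F α ≡ G α

infixl 6 _⊕_ _⊖_
_⊕_ _⊖_ : Coeffs n → Coeffs n → Coeffs n
(F ⊕ G) α = F α + G α
(F ⊖ G) α = F α - G α

⊝_ : Coeffs n → Coeffs n
(⊝ F) α = - F α

𝟘 : Coeffs n
𝟘 _ = 0ℤ

mulTerm : ℤ → Mono n → Coeffs n → Coeffs n
mulTerm c γ F α = if γ ∣ᵇ α then c * F (α ∸ᵐ γ) else 0ℤ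

mulTerm-identity : (F : Coeffs n) → mulTerm 1ℤ 𝟎 F ≐ F
mulTerm-identity F α rewrite 𝟎-∣ᵇ α | ∸ᵐ-identityʳ α = ℤₚ.*-identityˡ (F α)

mulTerm-𝟘 : ∀ c (γ : Mono n) → mulTerm c γ 𝟘 ≐ 𝟘
mulTerm-𝟘 c γ α with γ ∣ᵇ α
... | true  = ℤₚ.*-zeroʳ c
... | false = refl

mulTerm-⊕ : ∀ c (γ : Mono n) F G → mulTerm c γ (F ⊕ G) ≐ mulTerm c γ F ⊕ mulTerm c γ G
mulTerm-⊕ c γ F G α with γ ∣ᵇ α
... | true  = ℤₚ.*-distribˡ-+ c _ _
... | false = refl

mulTerm-⊝ : ∀ c (γ : Mono n) F → mulTerm c γ (⊝ F) ≐ ⊝ mulTerm c γ F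
mulTerm-⊝ c γ F α with γ ∣ᵇ α
... | true  = sym (ℤₚ.neg-distribʳ-* c _)
... | false = refl

mulTerm-mulTerm : ∀ c d (γ δ : Mono n) F →
  mulTerm c γ (mulTerm d δ F) ≐ mulTerm (c * d) (γ +ᵐ δ) F
mulTerm-mulTerm c d γ δ F α rewrite ∣ᵇ-split γ δ α with γ ∣ᵇ α
... | false = refl
... | true with δ ∣ᵇ α ∸ᵐ γ
...   | true  = trans (sym (ℤₚ.*-assoc c d _)) (cong (λ β → c * d * F β) (∸ᵐ-∸ᵐ α γ δ))
...   | false = ℤₚ.*-zeroʳ c

mulTerm-comm : ∀ c d (γ δ : Mono n) F → mulTerm c γ (mulTerm d δ F) ≐ mulTerm d δ (mulTerm c γ F)
mulTerm-comm c d γ δ F α = begin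
  mulTerm c γ (mulTerm d δ F) α ≡⟨ mulTerm-mulTerm c d γ δ F α ⟩
  mulTerm (c * d) (γ +ᵐ δ) F α  ≡⟨ cong₂ (λ e ε → mulTerm e ε F α) (ℤₚ.*-comm c d) (+ᵐ-comm γ δ) ⟩
  mulTerm (d * c) (δ +ᵐ γ) F α  ≡⟨ mulTerm-mulTerm d c δ γ F α ⟨
  mulTerm d δ (mulTerm c γ F) α ∎
  where open ≡-Reasoning

coeff-++ : (p q : Poly n) → coeff (p ++ q) ≐ coeff p ⊕ coeff q
coeff-++ []            q α = sym (ℤₚ.+-identityˡ _)
coeff-++ ((c , γ) ∷ p) q α with ≡-dec ℕ._≟_ γ α
... | yes _ = trans (cong (c +_) (coeff-++ p q α)) (sym (ℤₚ.+-assoc c _ _))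
... | no  _ = coeff-++ p q α

coeff-here : ∀ c (γ : Mono n) p {α} → γ ≡ α → coeff ((c , γ) ∷ p) α ≡ c + coeff p α
coeff-here c γ p {α} γ≡α with ≡-dec ℕ._≟_ γ α
... | yes _   = refl
... | no γ≢α = ⊥-elim (γ≢α γ≡α)

coeff-there : ∀ c (γ : Mono n) p {α} → γ ≢ α → coeff ((c , γ) ∷ p) α ≡ coeff p α
coeff-there c γ p {α} γ≢α with ≡-dec ℕ._≟_ γ α
... | yes γ≡α = ⊥-elim (γ≢α γ≡α)
... | no  _   = refl

-- ((c , γ) ∷ p) *P q reduces to termMul c γ q ++ p *P q.
termMul : ℤ → Mono n → Poly n → Poly n
termMul c γ = map (λ s → (c * proj₁ s , γ +ᵐ proj₂ s))

coeff-termMul-∣ : ∀ c (γ : Mono n) L α → γ ∣ᵇ α ≡ true →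
  coeff (termMul c γ L) α ≡ c * coeff L (α ∸ᵐ γ)
coeff-termMul-∣ c γ []            α γ∣α = sym (ℤₚ.*-zeroʳ c)
coeff-termMul-∣ c γ ((d , δ) ∷ L) α γ∣α
  with ≡-dec ℕ._≟_ (γ +ᵐ δ) α | ≡-dec ℕ._≟_ δ (α ∸ᵐ γ)
... | yes _    | yes _ = trans (cong (c * d +_) (coeff-termMul-∣ c γ L α γ∣α))
                               (sym (ℤₚ.*-distribˡ-+ c d _))
... | no  _    | no  _ = coeff-termMul-∣ c γ L α γ∣α
... | yes γδ≡α | no δ≢ = ⊥-elim (δ≢ (trans (sym (+ᵐ-∸ᵐ γ δ)) (cong (_∸ᵐ γ) γδ≡α)))
... | no γδ≢α  | yes δ≡ = ⊥-elim (γδ≢α (trans (cong (γ +ᵐ_) δ≡) (∣ᵇ⇒+ᵐ∸ᵐ γ α γ∣α)))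

coeff-termMul-∤ : ∀ c (γ : Mono n) L α → γ ∣ᵇ α ≡ false → coeff (termMul c γ L) α ≡ 0ℤ
coeff-termMul-∤ c γ []            α γ∤α = refl
coeff-termMul-∤ c γ ((d , δ) ∷ L) α γ∤α =
  trans (coeff-there _ _ _ γδ≢α) (coeff-termMul-∤ c γ L α γ∤α)
  where
  γδ≢α : γ +ᵐ δ ≢ α
  γδ≢α γδ≡α with () ← trans (sym (∣ᵇ-+ᵐ γ δ)) (trans (cong (γ ∣ᵇ_) γδ≡α) γ∤α)

coeff-termMul : ∀ c (γ : Mono n) L → coeff (termMul c γ L) ≐ mulTerm c γ (coeff L)
coeff-termMul c γ L α with γ ∣ᵇ α in eq
... | true  = coeff-termMul-∣ c γ L α eq
... | false = coeff-termMul-∤ c γ L α eq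

infixl 7 _⊙_
_⊙_ : Coeffs n → Poly n → Coeffs n
F ⊙ []            = 𝟘
F ⊙ ((c , γ) ∷ L) = mulTerm c γ F ⊕ F ⊙ L

⊙-++ : (F : Coeffs n) (L L′ : Poly n) → F ⊙ (L ++ L′) ≐ F ⊙ L ⊕ F ⊙ L′
⊙-++ F []            L′ α = sym (ℤₚ.+-identityˡ _)
⊙-++ F ((c , γ) ∷ L) L′ α =
  trans (cong (mulTerm c γ F α +_) (⊙-++ F L L′ α))
        (sym (ℤₚ.+-assoc (mulTerm c γ F α) ((F ⊙ L) α) ((F ⊙ L′) α)))

𝟘-⊙ : (L : Poly n) → 𝟘 ⊙ L ≐ 𝟘
𝟘-⊙ []            α = refl
𝟘-⊙ ((c , γ) ∷ L) α = cong₂ _+_ (mulTerm-𝟘 c γ α) (𝟘-⊙ L α)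

⊕-⊙ : (F G : Coeffs n) (L : Poly n) → (F ⊕ G) ⊙ L ≐ F ⊙ L ⊕ G ⊙ L
⊕-⊙ F G []            α = refl
⊕-⊙ F G ((c , γ) ∷ L) α =
  trans (cong₂ _+_ (mulTerm-⊕ c γ F G α) (⊕-⊙ F G L α))
        (interchange+ (mulTerm c γ F α) (mulTerm c γ G α) ((F ⊙ L) α) ((G ⊙ L) α))
  where
  interchange+ : ∀ a b x y → (a + b) + (x + y) ≡ (a + x) + (b + y)
  interchange+ = solve-∀

⊝-⊙ : (F : Coeffs n) (L : Poly n) → (⊝ F) ⊙ L ≐ ⊝ (F ⊙ L)
⊝-⊙ F []            α = refl
⊝-⊙ F ((c , γ) ∷ L) α =
  trans (cong₂ _+_ (mulTerm-⊝ c γ F α) (⊝-⊙ F L α))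
        (sym (ℤₚ.neg-distrib-+ (mulTerm c γ F α) ((F ⊙ L) α)))

mulTerm-⊙ : ∀ c (γ : Mono n) F L → mulTerm c γ F ⊙ L ≐ mulTerm c γ (F ⊙ L)
mulTerm-⊙ c γ F []            α = sym (mulTerm-𝟘 c γ α)
mulTerm-⊙ c γ F ((d , δ) ∷ L) α =
  trans (cong₂ _+_ (mulTerm-comm d c δ γ F α) (mulTerm-⊙ c γ F L α))
        (sym (mulTerm-⊕ c γ (mulTerm d δ F) (F ⊙ L) α))

𝟙 : Coeffs n
𝟙 = coeff [ (1ℤ , 𝟎) ]

mulTerm-𝟙 : ∀ c (γ : Mono n) → mulTerm c γ 𝟙 ≐ coeff [ (c , γ) ]
mulTerm-𝟙 c γ α = begin
  mulTerm c γ 𝟙 α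
    ≡⟨ coeff-termMul c γ [ (1ℤ , 𝟎) ] α ⟨
  coeff (termMul c γ [ (1ℤ , 𝟎) ]) α
    ≡⟨ cong₂ (λ e ε → coeff [ (e , ε) ] α) (ℤₚ.*-identityʳ c) (+ᵐ-identityʳ γ) ⟩
  coeff [ (c , γ) ] α ∎
  where open ≡-Reasoning

𝟙-⊙ : (L : Poly n) → 𝟙 ⊙ L ≐ coeff L
𝟙-⊙ []            α = refl
𝟙-⊙ ((c , γ) ∷ L) α =
  trans (cong₂ _+_ (mulTerm-𝟙 c γ α) (𝟙-⊙ L α)) (sym (coeff-++ [ (c , γ) ] L α))

data InJ {n} (b : Fin n → ℕ) : Coeffs n → Set where
  gen  : ∀ i → InJ b (coeff (eTilde (b i) (from i)))
  zer  : InJ b 𝟘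
  add  : ∀ {F G} → InJ b F → InJ b G → InJ b (F ⊕ G)
  neg  : ∀ {F} → InJ b F → InJ b (⊝ F)
  mul  : ∀ {F} c γ → InJ b F → InJ b (mulTerm c γ F)
  resp : ∀ {F G} → F ≐ G → InJ b F → InJ b G

linearCombination : List (Poly n × Poly n) → Poly n
linearCombination cs = sumP (map (λ c → proj₁ c *P proj₂ c) cs)

Generator : (Fin n → ℕ) → Poly n → Set
Generator {n} b g = Σ (Fin n) λ i → g ≡ eTilde (b i) (from i)

module _ {b : Fin n → ℕ} where

  ≐𝟘⇒InJ : ∀ {F} → F ≐ 𝟘 → InJ b F
  ≐𝟘⇒InJ F≐𝟘 = resp (λ α → sym (F≐𝟘 α)) zer

  InJ-minuend : ∀ {F G} → InJ b (F ⊖ G) → InJ b G → InJ b F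
  InJ-minuend {F} {G} F-G∈ G∈ = resp (λ α → [x-y]+y≡x (F α) (G α)) (add F-G∈ G∈)
    where
    [x-y]+y≡x : ∀ x y → (x - y) + y ≡ x
    [x-y]+y≡x = solve-∀

  InJ-subtrahend : ∀ {F G} → InJ b F → InJ b (F ⊖ G) → InJ b G
  InJ-subtrahend {F} {G} F∈ F-G∈ = resp (λ α → x-[x-y]≡y (F α) (G α)) (add F∈ (neg F-G∈))
    where
    x-[x-y]≡y : ∀ x y → x - (x - y) ≡ y
    x-[x-y]≡y = solve-∀

  InJ-⊙ : ∀ {F} → InJ b F → (L : Poly n) → InJ b (F ⊙ L)
  InJ-⊙ F∈ []            = zer
  InJ-⊙ F∈ ((c , γ) ∷ L) = add (mul c γ F∈) (InJ-⊙ F∈ L)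

  InJ-*P : (q G : Poly n) → InJ b (coeff G) → InJ b (coeff (q *P G))
  InJ-*P []            G G∈ = zer
  InJ-*P ((c , γ) ∷ q) G G∈ = resp coeff-∷-*P (add (mul c γ G∈) (InJ-*P q G G∈))
    where
    coeff-∷-*P : mulTerm c γ (coeff G) ⊕ coeff (q *P G) ≐ coeff (termMul c γ G ++ q *P G)
    coeff-∷-*P α = sym (trans (coeff-++ (termMul c γ G) (q *P G) α)
                              (cong (_+ coeff (q *P G) α) (coeff-termMul c γ G α)))

  Gen⇒InJ : ∀ f → Gen (Generator b) f → InJ b (coeff f)
  Gen⇒InJ f (cs , gens , f≈) = resp (λ α → sym (f≈ α)) (combination∈ cs gens)
    where
    combination∈ : ∀ cs → All (λ c → Generator b (proj₂ c)) cs →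
                   InJ b (coeff (linearCombination cs))
    combination∈ []             []                = zer
    combination∈ ((q , g) ∷ cs) ((i , refl) ∷ gens) =
      resp (λ α → sym (coeff-++ (q *P g) _ α)) (add (InJ-*P q g (gen i)) (combination∈ cs gens))

-- Coefficients of ẽ_d(S)

sumMonos : List (Mono n) → Poly n
sumMonos = map (1ℤ ,_)

supportedOfDegree : Subset n → ℕ → Mono n → Bool
supportedOfDegree []          d []      = d ℕ.≡ᵇ 0
supportedOfDegree (false ∷ S) d (a ∷ α) = (a ℕ.≡ᵇ 0) ∧ supportedOfDegree S d α
supportedOfDegree (true ∷ S)  d (a ∷ α) = leb a d ∧ supportedOfDegree S (d ℕ.∸ a) α

coeff-sumMonos-++ : (xs ys : List (Mono n)) →
  coeff (sumMonos (xs ++ ys)) ≐ coeff (sumMonos xs) ⊕ coeff (sumMonos ys)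
coeff-sumMonos-++ xs ys α =
  trans (cong (λ p → coeff p α) (Listₚ.map-++ _ xs ys)) (coeff-++ (sumMonos xs) (sumMonos ys) α)

coeff-sumMonos-∷ : ∀ a (Ms : List (Mono n)) α →
  coeff (sumMonos (map (a ∷_) Ms)) (a ∷ α) ≡ coeff (sumMonos Ms) α
coeff-sumMonos-∷ a []       α = refl
coeff-sumMonos-∷ {n = n} a (δ ∷ Ms) α = by-cases (≡-dec ℕ._≟_ δ α)
  where
  aMs : Poly (suc n)
  aMs = sumMonos (map (a ∷_) Ms)
  by-cases : Dec (δ ≡ α) → coeff ((1ℤ , a ∷ δ) ∷ aMs) (a ∷ α) ≡ coeff (sumMonos (δ ∷ Ms)) α
  by-cases (yes δ≡α) = begin
    coeff ((1ℤ , a ∷ δ) ∷ aMs) (a ∷ α) ≡⟨ coeff-here 1ℤ (a ∷ δ) aMs (cong (a ∷_) δ≡α) ⟩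
    1ℤ + coeff aMs (a ∷ α)             ≡⟨ cong (1ℤ +_) (coeff-sumMonos-∷ a Ms α) ⟩
    1ℤ + coeff (sumMonos Ms) α         ≡⟨ coeff-here 1ℤ δ (sumMonos Ms) δ≡α ⟨
    coeff (sumMonos (δ ∷ Ms)) α        ∎
    where open ≡-Reasoning
  by-cases (no δ≢α) = begin
    coeff ((1ℤ , a ∷ δ) ∷ aMs) (a ∷ α) ≡⟨ coeff-there 1ℤ (a ∷ δ) aMs (δ≢α ∘′ ∷-injectiveʳ) ⟩
    coeff aMs (a ∷ α)                  ≡⟨ coeff-sumMonos-∷ a Ms α ⟩
    coeff (sumMonos Ms) α              ≡⟨ coeff-there 1ℤ δ (sumMonos Ms) δ≢α ⟨
    coeff (sumMonos (δ ∷ Ms)) α        ∎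
    where open ≡-Reasoning

coeff-sumMonos-∷-≢ : ∀ {k a} (Ms : List (Mono n)) α → k ≢ a →
  coeff (sumMonos (map (k ∷_) Ms)) (a ∷ α) ≡ 0ℤ
coeff-sumMonos-∷-≢ []       α k≢a = refl
coeff-sumMonos-∷-≢ {k = k} (δ ∷ Ms) α k≢a =
  trans (coeff-there 1ℤ (k ∷ δ) (sumMonos (map (k ∷_) Ms)) (k≢a ∘′ ∷-injectiveˡ))
        (coeff-sumMonos-∷-≢ Ms α k≢a)

blocks : (ℕ → List (Mono n)) → List ℕ → List (Mono (suc n))
blocks M = concatMap (λ k → map (k ∷_) (M k))

coeff-block : ∀ (M : ℕ → List (Mono n)) a α →
  coeff (sumMonos (blocks M [ a ])) (a ∷ α) ≡ coeff (sumMonos (M a)) α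
coeff-block M a α =
  trans (cong (λ xs → coeff (sumMonos xs) (a ∷ α)) (Listₚ.++-identityʳ (map (a ∷_) (M a))))
        (coeff-sumMonos-∷ a (M a) α)

coeff-block-≢ : ∀ (M : ℕ → List (Mono n)) {k a} α → k ≢ a →
  coeff (sumMonos (blocks M [ k ])) (a ∷ α) ≡ 0ℤ
coeff-block-≢ M {k} {a} α k≢a =
  trans (cong (λ xs → coeff (sumMonos xs) (a ∷ α)) (Listₚ.++-identityʳ (map (k ∷_) (M k))))
        (coeff-sumMonos-∷-≢ (M k) α k≢a)

coeff-blocks-upTo : ∀ (M : ℕ → List (Mono n)) d a α →
  coeff (sumMonos (blocks M (upTo (suc d)))) (a ∷ α)
    ≡ (if leb a d then coeff (sumMonos (M a)) α else 0ℤ)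
coeff-blocks-upTo M zero zero    α = coeff-block M 0 α
coeff-blocks-upTo M zero (suc a) α = coeff-block-≢ M α (λ ())
coeff-blocks-upTo M (suc d) a α = begin
  coeff (sumMonos (blocks M (upTo (suc (suc d))))) (a ∷ α)
    ≡⟨ cong (λ ks → coeff (sumMonos (blocks M ks)) (a ∷ α)) (Listₚ.upTo-∷ʳ (suc d)) ⟨
  coeff (sumMonos (blocks M (upTo (suc d) ∷ʳ suc d))) (a ∷ α)
    ≡⟨ cong (λ xs → coeff (sumMonos xs) (a ∷ α))
            (Listₚ.concatMap-++ (λ k → map (k ∷_) (M k)) (upTo (suc d)) [ suc d ]) ⟩
  coeff (sumMonos (blocks M (upTo (suc d)) ++ blocks M [ suc d ])) (a ∷ α)
    ≡⟨ coeff-sumMonos-++ (blocks M (upTo (suc d))) _ (a ∷ α) ⟩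
  coeff (sumMonos (blocks M (upTo (suc d)))) (a ∷ α) + coeff (sumMonos (blocks M [ suc d ])) (a ∷ α)
    ≡⟨ cong (_+ coeff (sumMonos (blocks M [ suc d ])) (a ∷ α)) (coeff-blocks-upTo M d a α) ⟩
  (if leb a d then X else 0ℤ) + coeff (sumMonos (blocks M [ suc d ])) (a ∷ α)
    ≡⟨ by-cases (ℕₚ.<-cmp a (suc d)) ⟩
  (if leb a (suc d) then X else 0ℤ) ∎
  where
  open ≡-Reasoning
  X : ℤ
  X = coeff (sumMonos (M a)) α
  by-cases : Tri (a < suc d) (a ≡ suc d) (a ℕ.> suc d) →
             (if leb a d then X else 0ℤ) + coeff (sumMonos (blocks M [ suc d ])) (a ∷ α)
             ≡ (if leb a (suc d) then X else 0ℤ)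
  by-cases (tri< (s≤s a≤d) a≢1+d _)
    rewrite ≤⇒leb a≤d | ≤⇒leb (ℕₚ.m≤n⇒m≤1+n a≤d) | coeff-block-≢ M α (a≢1+d ∘′ sym) = ℤₚ.+-identityʳ X
  by-cases (tri≈ _ refl _)
    rewrite >⇒leb (ℕₚ.n<1+n d) | ≤⇒leb (ℕₚ.≤-refl {suc d}) | coeff-block M (suc d) α = ℤₚ.+-identityˡ X
  by-cases (tri> _ a≢1+d 1+d<a)
    rewrite >⇒leb (ℕₚ.<-trans (ℕₚ.n<1+n d) 1+d<a) | >⇒leb 1+d<a | coeff-block-≢ M α (a≢1+d ∘′ sym) = refl

coeff-eTilde : ∀ (S : Subset n) d α →
  coeff (eTilde d S) α ≡ (if supportedOfDegree S d α then 1ℤ else 0ℤ)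
coeff-eTilde []          zero    []            = refl
coeff-eTilde []          (suc d) []            = refl
coeff-eTilde (false ∷ S) d       (zero ∷ α)    =
  trans (coeff-sumMonos-∷ 0 (monos _ S d) α) (coeff-eTilde S d α)
coeff-eTilde (false ∷ S) d       (suc a ∷ α)   = coeff-sumMonos-∷-≢ (monos _ S d) α (λ ())
coeff-eTilde (true ∷ S)  d       (a ∷ α)       =
  trans (coeff-blocks-upTo (λ k → monos _ S (d ℕ.∸ k)) d a α) (by-cases (leb a d))
  where
  by-cases : ∀ t → (if t then coeff (eTilde (d ℕ.∸ a) S) α else 0ℤ)
                   ≡ (if t ∧ supportedOfDegree S (d ℕ.∸ a) α then 1ℤ else 0ℤ)
  by-cases true  = coeff-eTilde S (d ℕ.∸ a) α
  by-cases false = refl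

pureExp : Fin n → ℕ → Mono n
pureExp i b = 𝟎 [ i ]≔ b

≤ᵇ-suc : ∀ m n → (suc m ℕ.≤ᵇ suc n) ≡ (m ℕ.≤ᵇ n)
≤ᵇ-suc zero    n = refl
≤ᵇ-suc (suc m) n = refl

from-suc : (k : Fin n) → from (fsuc k) ≡ false ∷ from k
from-suc k = cong (false ∷_) (tabulate-cong (λ j → ≤ᵇ-suc (toℕ k) (toℕ j)))

supportedOfDegree-𝟎 : (S : Subset n) → supportedOfDegree S 0 𝟎 ≡ true
supportedOfDegree-𝟎 []          = refl
supportedOfDegree-𝟎 (false ∷ S) = supportedOfDegree-𝟎 S
supportedOfDegree-𝟎 (true ∷ S)  = supportedOfDegree-𝟎 S

supportedOfDegree-0->lex : (S : Subset n) (γ : Mono n) → γ >lex 𝟎 → supportedOfDegree S 0 γ ≡ false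
supportedOfDegree-0->lex (false ∷ S) (suc g ∷ γ) (here _)  = refl
supportedOfDegree-0->lex (true ∷ S)  (suc g ∷ γ) (here _)  = refl
supportedOfDegree-0->lex (false ∷ S) (zero ∷ γ)  (there p) = supportedOfDegree-0->lex S γ p
supportedOfDegree-0->lex (true ∷ S)  (zero ∷ γ)  (there p) = supportedOfDegree-0->lex S γ p

supportedOfDegree-pureExp : (i : Fin n) (b : ℕ) → supportedOfDegree (from i) b (pureExp i b) ≡ true
supportedOfDegree-pureExp {suc n} fzero b
  rewrite ≤⇒leb (ℕₚ.≤-refl {b}) | ℕₚ.n∸n≡0 b = supportedOfDegree-𝟎 {n} (tabulate (λ _ → true))
supportedOfDegree-pureExp (fsuc k) b =
  trans (cong (λ S → supportedOfDegree S b (pureExp (fsuc k) b)) (from-suc k)) (supportedOfDegree-pureExp k b)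

supportedOfDegree->lex-pureExp : (i : Fin n) (b : ℕ) (γ : Mono n) → γ >lex pureExp i b →
  supportedOfDegree (from i) b γ ≡ false
supportedOfDegree->lex-pureExp fzero b (g ∷ γ) (here b<g) rewrite >⇒leb b<g = refl
supportedOfDegree->lex-pureExp fzero b (g ∷ γ) (there p)
  rewrite ≤⇒leb (ℕₚ.≤-refl {b}) | ℕₚ.n∸n≡0 b = supportedOfDegree-0->lex (tabulate (λ _ → true)) γ p
supportedOfDegree->lex-pureExp (fsuc k) b (g ∷ γ) p =
  trans (cong (λ S → supportedOfDegree S b (g ∷ γ)) (from-suc k)) (first-variable p)
  where
  first-variable : (g ∷ γ) >lex (0 ∷ pureExp k b) →
                   ((g ℕ.≡ᵇ 0) ∧ supportedOfDegree (from k) b γ) ≡ false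
  first-variable (here {a = suc _} _) = refl
  first-variable (there q)            = supportedOfDegree->lex-pureExp k b γ q

eTilde-leadingTerm : (i : Fin n) (b : ℕ) → IsLeadingTerm (eTilde b (from i)) 1ℤ (pureExp i b)
eTilde-leadingTerm i b = coefficient , (λ ()) , above-vanishes
  where
  coefficient : coeff (eTilde b (from i)) (pureExp i b) ≡ 1ℤ
  coefficient = trans (coeff-eTilde (from i) b (pureExp i b))
                      (cong (if_then 1ℤ else 0ℤ) (supportedOfDegree-pureExp i b))
  above-vanishes : ∀ γ → γ >lex pureExp i b → coeff (eTilde b (from i)) γ ≡ 0ℤ
  above-vanishes γ γ>lex = trans (coeff-eTilde (from i) b γ)
                                 (cong (if_then 1ℤ else 0ℤ) (supportedOfDegree->lex-pureExp i b γ γ>lex))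

slice : ℕ → Coeffs (suc n) → Coeffs n
slice j F α = F (j ∷ α)

slice-zero-eTilde-from-suc : ∀ (k : Fin n) d →
  slice 0 (coeff (eTilde d (from (fsuc k)))) ≐ coeff (eTilde d (from k))
slice-zero-eTilde-from-suc k d α = begin
  coeff (eTilde d (from (fsuc k))) (0 ∷ α)
    ≡⟨ coeff-eTilde (from (fsuc k)) d (0 ∷ α) ⟩
  (if supportedOfDegree (from (fsuc k)) d (0 ∷ α) then 1ℤ else 0ℤ)
    ≡⟨ cong (λ S → if supportedOfDegree S d (0 ∷ α) then 1ℤ else 0ℤ) (from-suc k) ⟩
  (if supportedOfDegree (from k) d α then 1ℤ else 0ℤ)
    ≡⟨ coeff-eTilde (from k) d α ⟨
  coeff (eTilde d (from k)) α ∎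
  where open ≡-Reasoning

slice-suc-eTilde-from-suc : ∀ (k : Fin n) d j → slice (suc j) (coeff (eTilde d (from (fsuc k)))) ≐ 𝟘
slice-suc-eTilde-from-suc k d j α =
  trans (coeff-eTilde (from (fsuc k)) d (suc j ∷ α))
        (cong (λ S → if supportedOfDegree S d (suc j ∷ α) then 1ℤ else 0ℤ) (from-suc k))

-- Splitting off the first variable

slice-mulTerm-∣ : ∀ c e (γ : Mono n) F j → leb e j ≡ true →
  slice j (mulTerm c (e ∷ γ) F) ≐ mulTerm c γ (slice (j ℕ.∸ e) F)
slice-mulTerm-∣ c e γ F j e≤j α rewrite e≤j = refl

slice-mulTerm-∤ : ∀ c e (γ : Mono n) F j → leb e j ≡ false → slice j (mulTerm c (e ∷ γ) F) ≐ 𝟘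
slice-mulTerm-∤ c e γ F j e>j α rewrite e>j = refl

⊙-sumMonos-++ : (F : Coeffs n) (xs ys : List (Mono n)) →
  F ⊙ sumMonos (xs ++ ys) ≐ F ⊙ sumMonos xs ⊕ F ⊙ sumMonos ys
⊙-sumMonos-++ F xs ys α =
  trans (cong (λ L → (F ⊙ L) α) (Listₚ.map-++ _ xs ys)) (⊙-++ F (sumMonos xs) (sumMonos ys) α)

slice-⊙-block-∣ : ∀ (Q : Coeffs (suc n)) k (Ms : List (Mono n)) j → leb k j ≡ true →
  slice j (Q ⊙ sumMonos (map (k ∷_) Ms)) ≐ slice (j ℕ.∸ k) Q ⊙ sumMonos Ms
slice-⊙-block-∣ Q k []       j k≤j α = refl
slice-⊙-block-∣ Q k (δ ∷ Ms) j k≤j α =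
  cong₂ _+_ (slice-mulTerm-∣ 1ℤ k δ Q j k≤j α) (slice-⊙-block-∣ Q k Ms j k≤j α)

slice-⊙-block-∤ : ∀ (Q : Coeffs (suc n)) k (Ms : List (Mono n)) j → leb k j ≡ false →
  slice j (Q ⊙ sumMonos (map (k ∷_) Ms)) ≐ 𝟘
slice-⊙-block-∤ Q k []       j k>j α = refl
slice-⊙-block-∤ Q k (δ ∷ Ms) j k>j α =
  cong₂ _+_ (slice-mulTerm-∤ 1ℤ k δ Q j k>j α) (slice-⊙-block-∤ Q k Ms j k>j α)

monos-zero : ∀ n (S : Subset n) → monos n S 0 ≡ [ 𝟎 ]
monos-zero zero    []          = refl
monos-zero (suc n) (false ∷ S) rewrite monos-zero n S = refl
monos-zero (suc n) (true ∷ S)  rewrite monos-zero n S = refl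

x₁-degree< : Coeffs (suc n) → ℕ → Set
x₁-degree< F T = ∀ a α → T ≤ a → F (a ∷ α) ≡ 0ℤ

x₁-degree<-mulTerm : ∀ c e (γ : Mono n) {Q T} → x₁-degree< Q T →
  x₁-degree< (mulTerm c (e ∷ γ) Q) (T ℕ.+ e)
x₁-degree<-mulTerm c e γ {Q} {T} Q<T a α T+e≤a with (e ∷ γ) ∣ᵇ (a ∷ α)
... | false = refl
... | true  = trans (cong (c *_) (Q<T (a ℕ.∸ e) (α ∸ᵐ γ) (ℕₚ.m+n≤o⇒m≤o∸n T T+e≤a))) (ℤₚ.*-zeroʳ c)

module FirstVariable {n} (b : Fin (suc n) → ℕ) where

  b′ : Fin n → ℕ
  b′ k = b (fsuc k)

  β : ℕ
  β = b fzero

  g₁ : Poly (suc n)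
  g₁ = eTilde β (from fzero)

  Slices∈J′ : Coeffs (suc n) → Set
  Slices∈J′ F = ∀ j → InJ b′ (slice j F)

  Slices∈J′-resp : ∀ {F G} → F ≐ G → Slices∈J′ F → Slices∈J′ G
  Slices∈J′-resp F≐G F∈ j = resp (λ α → F≐G (_ ∷ α)) (F∈ j)

  Slices∈J′-mulTerm : ∀ {F} c γ → Slices∈J′ F → Slices∈J′ (mulTerm c γ F)
  Slices∈J′-mulTerm {F} c (e ∷ γ) F∈ j = by-cases (leb e j) refl
    where
    by-cases : ∀ t → leb e j ≡ t → InJ b′ (slice j (mulTerm c (e ∷ γ) F))
    by-cases true  e≤j = resp (λ α → sym (slice-mulTerm-∣ c e γ F j e≤j α)) (mul c γ (F∈ (j ℕ.∸ e)))
    by-cases false e>j = ≐𝟘⇒InJ (slice-mulTerm-∤ c e γ F j e>j)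

  Slices∈J′-⊙ : ∀ {F} → Slices∈J′ F → (L : Poly (suc n)) → Slices∈J′ (F ⊙ L)
  Slices∈J′-⊙ F∈ []            j = zer
  Slices∈J′-⊙ {F} F∈ ((c , γ) ∷ L) j = add (Slices∈J′-mulTerm {F} c γ F∈ j) (Slices∈J′-⊙ F∈ L j)

  record Decomposition (p : Coeffs (suc n)) : Set where
    field
      quotient          : Coeffs (suc n)
      degree            : ℕ
      quotient-degree   : x₁-degree< quotient degree
      remainder-slices∈ : Slices∈J′ (p ⊖ quotient ⊙ g₁)
  open Decomposition public

  decomposition-resp : ∀ {p p′} → p ≐ p′ → Decomposition p → Decomposition p′
  decomposition-resp p≐p′ D = record
    { quotient          = quotient D
    ; degree            = degree D
    ; quotient-degree   = quotient-degree D
    ; remainder-slices∈ =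
        Slices∈J′-resp (λ α → cong (_- (quotient D ⊙ g₁) α) (p≐p′ α)) (remainder-slices∈ D)
    }

  decomposition-slices∈ : ∀ {p} → Slices∈J′ p → Decomposition p
  decomposition-slices∈ {p} p∈ = record
    { quotient          = 𝟘
    ; degree            = 0
    ; quotient-degree   = λ _ _ _ → refl
    ; remainder-slices∈ = Slices∈J′-resp p≐p-𝟘⊙g₁ p∈
    }
    where
    p≐p-𝟘⊙g₁ : p ≐ p ⊖ 𝟘 ⊙ g₁
    p≐p-𝟘⊙g₁ α = sym (trans (cong (_-_ (p α)) (𝟘-⊙ g₁ α)) (ℤₚ.+-identityʳ (p α)))

  decomposition-g₁ : Decomposition (coeff g₁)
  decomposition-g₁ = record
    { quotient          = 𝟙
    ; degree            = 1
    ; quotient-degree   = λ { (suc a) α _ → coeff-there 1ℤ 𝟎 [] {suc a ∷ α} (λ ()) }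
    ; remainder-slices∈ = λ j → ≐𝟘⇒InJ (λ α → g₁-g₁≐𝟘 (j ∷ α))
    }
    where
    g₁-g₁≐𝟘 : coeff g₁ ⊖ 𝟙 ⊙ g₁ ≐ 𝟘
    g₁-g₁≐𝟘 α = trans (cong (_-_ (coeff g₁ α)) (𝟙-⊙ g₁ α)) (ℤₚ.+-inverseʳ (coeff g₁ α))

  decomposition-⊕ : ∀ {F G} → Decomposition F → Decomposition G → Decomposition (F ⊕ G)
  decomposition-⊕ {F} {G} D E = record
    { quotient          = quotient D ⊕ quotient E
    ; degree            = degree D ℕ.+ degree E
    ; quotient-degree   = λ a α T≤a → cong₂ _+_
        (quotient-degree D a α (ℕₚ.≤-trans (ℕₚ.m≤m+n (degree D) (degree E)) T≤a))
        (quotient-degree E a α (ℕₚ.≤-trans (ℕₚ.m≤n+m (degree E) (degree D)) T≤a))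
    ; remainder-slices∈ = Slices∈J′-resp sum-of-remainders
        (λ j → add (remainder-slices∈ D j) (remainder-slices∈ E j))
    }
    where
    Q : Coeffs (suc n)
    Q = quotient D
    R : Coeffs (suc n)
    R = quotient E
    sum-of-remainders : (F ⊖ Q ⊙ g₁) ⊕ (G ⊖ R ⊙ g₁) ≐ F ⊕ G ⊖ (Q ⊕ R) ⊙ g₁
    sum-of-remainders α = trans (rearrange (F α) (G α) ((Q ⊙ g₁) α) ((R ⊙ g₁) α))
                                (cong (_-_ (F α + G α)) (sym (⊕-⊙ Q R g₁ α)))
      where
      rearrange : ∀ f g x y → (f - x) + (g - y) ≡ (f + g) - (x + y)
      rearrange = solve-∀

  decomposition-⊝ : ∀ {F} → Decomposition F → Decomposition (⊝ F)
  decomposition-⊝ {F} D = record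
    { quotient          = ⊝ Q
    ; degree            = degree D
    ; quotient-degree   = λ a α T≤a → cong -_ (quotient-degree D a α T≤a)
    ; remainder-slices∈ = Slices∈J′-resp negated-remainder (λ j → neg (remainder-slices∈ D j))
    }
    where
    Q : Coeffs (suc n)
    Q = quotient D
    negated-remainder : ⊝ (F ⊖ Q ⊙ g₁) ≐ ⊝ F ⊖ (⊝ Q) ⊙ g₁
    negated-remainder α = trans (rearrange (F α) ((Q ⊙ g₁) α)) (cong (_-_ (- F α)) (sym (⊝-⊙ Q g₁ α)))
      where
      rearrange : ∀ f x → - (f - x) ≡ - f - - x
      rearrange = solve-∀

  decomposition-mulTerm : ∀ {F} c γ → Decomposition F → Decomposition (mulTerm c γ F)
  decomposition-mulTerm {F} c (e ∷ γ) D = record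
    { quotient          = mulTerm c (e ∷ γ) Q
    ; degree            = degree D ℕ.+ e
    ; quotient-degree   = x₁-degree<-mulTerm c e γ {Q} (quotient-degree D)
    ; remainder-slices∈ = Slices∈J′-resp shifted-remainder
        (Slices∈J′-mulTerm {F ⊖ Q ⊙ g₁} c (e ∷ γ) (remainder-slices∈ D))
    }
    where
    Q : Coeffs (suc n)
    Q = quotient D
    shifted-remainder : mulTerm c (e ∷ γ) (F ⊖ Q ⊙ g₁)
                        ≐ mulTerm c (e ∷ γ) F ⊖ mulTerm c (e ∷ γ) Q ⊙ g₁
    shifted-remainder α = begin
      mulTerm c (e ∷ γ) (F ⊕ ⊝ (Q ⊙ g₁)) α
        ≡⟨ mulTerm-⊕ c (e ∷ γ) F (⊝ (Q ⊙ g₁)) α ⟩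
      mulTerm c (e ∷ γ) F α + mulTerm c (e ∷ γ) (⊝ (Q ⊙ g₁)) α
        ≡⟨ cong (mulTerm c (e ∷ γ) F α +_) (mulTerm-⊝ c (e ∷ γ) (Q ⊙ g₁) α) ⟩
      mulTerm c (e ∷ γ) F α - mulTerm c (e ∷ γ) (Q ⊙ g₁) α
        ≡⟨ cong (_-_ (mulTerm c (e ∷ γ) F α)) (mulTerm-⊙ c (e ∷ γ) Q g₁ α) ⟨
      mulTerm c (e ∷ γ) F α - (mulTerm c (e ∷ γ) Q ⊙ g₁) α ∎
      where open ≡-Reasoning

  decompose : ∀ {p} → InJ b p → Decomposition p
  decompose (gen fzero)        = decomposition-g₁
  decompose (gen (fsuc k))     = decomposition-slices∈ generator-slices∈
    where
    generator-slices∈ : Slices∈J′ (coeff (eTilde (b′ k) (from (fsuc k))))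
    generator-slices∈ zero    = resp (λ α → sym (slice-zero-eTilde-from-suc k (b′ k) α)) (gen k)
    generator-slices∈ (suc j) = ≐𝟘⇒InJ (slice-suc-eTilde-from-suc k (b′ k) j)
  decompose zer                = decomposition-slices∈ (λ _ → zer)
  decompose (add F∈ G∈)        = decomposition-⊕ (decompose F∈) (decompose G∈)
  decompose (neg F∈)           = decomposition-⊝ (decompose F∈)
  decompose (mul c γ F∈)       = decomposition-mulTerm c γ (decompose F∈)
  decompose (resp F≐G F∈)      = decomposition-resp F≐G (decompose F∈)

  S : Subset n
  S = Vec.tail (from {suc n} fzero)

  M : ℕ → List (Mono n)
  M k = monos n S (β ℕ.∸ k)

  -- g₁ = Σ_{k ≤ β} x₁^k·ẽ_{β−k}(x₂,…,x_n), whose top block is x₁^β·1.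
  g₁-blocks : g₁ ≡ sumMonos (blocks M (upTo β ++ [ β ]))
  g₁-blocks = cong (λ ks → sumMonos (blocks M ks)) (sym (Listₚ.upTo-∷ʳ β))

  module _ (Q : Coeffs (suc n)) where

    lowerBlocks∈ : ∀ j → (∀ k → k < β → InJ b′ (slice (j ℕ.∸ k) Q)) →
      ∀ ks → All (_< β) ks → InJ b′ (slice j (Q ⊙ sumMonos (blocks M ks)))
    lowerBlocks∈ j Q∈ []       []            = zer
    lowerBlocks∈ j Q∈ (k ∷ ks) (k<β ∷ ks<β) =
      resp (λ α → sym (⊙-sumMonos-++ Q (map (k ∷_) (M k)) (blocks M ks) (j ∷ α)))
           (add (block∈ (leb k j) refl) (lowerBlocks∈ j Q∈ ks ks<β))
      where
      block∈ : ∀ t → leb k j ≡ t → InJ b′ (slice j (Q ⊙ sumMonos (map (k ∷_) (M k))))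
      block∈ true  k≤j = resp (λ α → sym (slice-⊙-block-∣ Q k (M k) j k≤j α))
                              (InJ-⊙ (Q∈ k k<β) (sumMonos (M k)))
      block∈ false k>j = ≐𝟘⇒InJ (slice-⊙-block-∤ Q k (M k) j k>j)

    slice-⊙-topBlock : ∀ a → slice (a ℕ.+ β) (Q ⊙ sumMonos (blocks M [ β ])) ≐ slice a Q
    slice-⊙-topBlock a α = begin
      (Q ⊙ sumMonos (map (β ∷_) (M β) ++ [])) (a ℕ.+ β ∷ α)
        ≡⟨ ⊙-sumMonos-++ Q (map (β ∷_) (M β)) [] (a ℕ.+ β ∷ α) ⟩
      (Q ⊙ sumMonos (map (β ∷_) (M β))) (a ℕ.+ β ∷ α) + 0ℤ
        ≡⟨ ℤₚ.+-identityʳ _ ⟩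
      (Q ⊙ sumMonos (map (β ∷_) (M β))) (a ℕ.+ β ∷ α)
        ≡⟨ slice-⊙-block-∣ Q β (M β) (a ℕ.+ β) (≤⇒leb (ℕₚ.m≤n+m β a)) α ⟩
      (slice (a ℕ.+ β ℕ.∸ β) Q ⊙ sumMonos (M β)) α
        ≡⟨ cong₂ (λ a′ Ms → (slice a′ Q ⊙ sumMonos Ms) α) (ℕₚ.m+n∸n≡m a β) M-β≡[𝟎] ⟩
      mulTerm 1ℤ 𝟎 (slice a Q) α + 0ℤ
        ≡⟨ ℤₚ.+-identityʳ _ ⟩
      mulTerm 1ℤ 𝟎 (slice a Q) α
        ≡⟨ mulTerm-identity (slice a Q) α ⟩
      slice a Q α ∎
      where
      open ≡-Reasoning
      M-β≡[𝟎] : M β ≡ [ 𝟎 ]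
      M-β≡[𝟎] = trans (cong (monos n S) (ℕₚ.n∸n≡0 β)) (monos-zero n S)

    -- The x₁^(a+β)-coefficient of Q·g₁ is that of x₁^a in Q plus terms from higher coefficients of Q.
    slice-⊙g₁∈ : ∀ a → (∀ a′ → a < a′ → InJ b′ (slice a′ Q)) →
      InJ b′ (slice (a ℕ.+ β) (Q ⊙ g₁) ⊖ slice a Q)
    slice-⊙g₁∈ a higher∈ =
      resp lower≐ (lowerBlocks∈ (a ℕ.+ β) shifted∈ (upTo β) (All.applyUpTo⁺₁ id β id))
      where
      shifted∈ : ∀ k → k < β → InJ b′ (slice (a ℕ.+ β ℕ.∸ k) Q)
      shifted∈ k k<β = higher∈ _ (subst (a <_) (sym (ℕₚ.+-∸-assoc a (ℕₚ.<⇒≤ k<β)))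
                                          (ℕₚ.m<m+n a (ℕₚ.m<n⇒0<n∸m k<β)))
      lower≐ : slice (a ℕ.+ β) (Q ⊙ sumMonos (blocks M (upTo β)))
               ≐ slice (a ℕ.+ β) (Q ⊙ g₁) ⊖ slice a Q
      lower≐ α = sym (begin
        (Q ⊙ g₁) (a ℕ.+ β ∷ α) - Q (a ∷ α)
          ≡⟨ cong (λ g → (Q ⊙ g) (a ℕ.+ β ∷ α) - Q (a ∷ α)) g₁-blocks ⟩
        (Q ⊙ sumMonos (blocks M (upTo β ++ [ β ]))) (a ℕ.+ β ∷ α) - Q (a ∷ α)
          ≡⟨ cong (λ L → (Q ⊙ sumMonos L) (a ℕ.+ β ∷ α) - Q (a ∷ α))
                  (Listₚ.concatMap-++ (λ k → map (k ∷_) (M k)) (upTo β) [ β ]) ⟩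
        (Q ⊙ sumMonos (blocks M (upTo β) ++ blocks M [ β ])) (a ℕ.+ β ∷ α) - Q (a ∷ α)
          ≡⟨ cong (_- Q (a ∷ α))
                  (⊙-sumMonos-++ Q (blocks M (upTo β)) (blocks M [ β ]) (a ℕ.+ β ∷ α)) ⟩
        (X + (Q ⊙ sumMonos (blocks M [ β ])) (a ℕ.+ β ∷ α)) - Q (a ∷ α)
          ≡⟨ cong (λ y → (X + y) - Q (a ∷ α)) (slice-⊙-topBlock a α) ⟩
        (X + Q (a ∷ α)) - Q (a ∷ α)
          ≡⟨ [x+y]-y≡x X (Q (a ∷ α)) ⟩
        X ∎)
        where
        open ≡-Reasoning
        X : ℤ
        X = (Q ⊙ sumMonos (blocks M (upTo β))) (a ℕ.+ β ∷ α)
        [x+y]-y≡x : ∀ x y → (x + y) - y ≡ x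
        [x+y]-y≡x = solve-∀

  -- Induction on the distance m from a up to the degree of the quotient, where its slices vanish.
  quotient-slices∈ : ∀ {p d} (D : Decomposition p) → d < β → (∀ a → d < a → slice a p ≐ 𝟘) →
    Slices∈J′ (quotient D)
  quotient-slices∈ {p} {d} D d<β p-above-d a = downward (degree D) a (ℕₚ.m≤n+m (degree D) a)
    where
    Q : Coeffs (suc n)
    Q = quotient D
    downward : ∀ m a → degree D ≤ a ℕ.+ m → InJ b′ (slice a Q)
    downward zero    a T≤a   =
      ≐𝟘⇒InJ (λ α → quotient-degree D a α (subst (degree D ≤_) (ℕₚ.+-identityʳ a) T≤a))
    downward (suc m) a T≤a+1+m = InJ-subtrahend top∈ (slice-⊙g₁∈ Q a higher∈)
      where
      higher∈ : ∀ a′ → a < a′ → InJ b′ (slice a′ Q)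
      higher∈ a′ a<a′ = downward m a′
        (ℕₚ.≤-trans T≤a+1+m (ℕₚ.≤-trans (ℕₚ.≤-reflexive (ℕₚ.+-suc a m)) (ℕₚ.+-monoˡ-≤ m a<a′)))
      top∈ : InJ b′ (slice (a ℕ.+ β) (Q ⊙ g₁))
      top∈ = InJ-subtrahend (≐𝟘⇒InJ (p-above-d (a ℕ.+ β) (ℕₚ.≤-trans d<β (ℕₚ.m≤n+m β a))))
                            (remainder-slices∈ D (a ℕ.+ β))

-- Leading exponents in J_b

IsLeadingExponent : Coeffs n → Mono n → Set
IsLeadingExponent p α = (p α ≢ 0ℤ) × (∀ γ → γ >lex α → p γ ≡ 0ℤ)

InJ-no-variables : ∀ {b : Fin 0 → ℕ} {p} → InJ b p → p ≐ 𝟘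
InJ-no-variables zer            α  = refl
InJ-no-variables (add F∈ G∈)    α  = cong₂ _+_ (InJ-no-variables F∈ α) (InJ-no-variables G∈ α)
InJ-no-variables (neg F∈)       α  = cong -_ (InJ-no-variables F∈ α)
InJ-no-variables (mul c [] F∈)  [] = trans (cong (c *_) (InJ-no-variables F∈ [])) (ℤₚ.*-zeroʳ c)
InJ-no-variables (resp F≐G F∈)  α  = trans (sym (F≐G α)) (InJ-no-variables F∈ α)

leadingExponent-divisible : ∀ {n} (b : Fin n → ℕ) {p α} → InJ b p → IsLeadingExponent p α →
  ∃ λ i → b i ≤ lookup α i
leadingExponent-divisible {zero}  b {α = []}    p∈ (p≢0 , _) = ⊥-elim (p≢0 (InJ-no-variables p∈ []))
leadingExponent-divisible {suc n} b {p} {d ∷ α} p∈ (p≢0 , p-top) with b fzero ℕ.≤? d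
... | yes β≤d = fzero , β≤d
... | no  β≰d =
  Product.map fsuc id (leadingExponent-divisible b′ slice-d∈ (p≢0 , λ γ γ>α → p-top (d ∷ γ) (there γ>α)))
  where
  open FirstVariable b
  D : Decomposition p
  D = decompose p∈
  quotient∈ : Slices∈J′ (quotient D)
  quotient∈ = quotient-slices∈ D (ℕₚ.≰⇒> β≰d) (λ a d<a γ → p-top (a ∷ γ) (here d<a))
  slice-d∈ : InJ b′ (slice d p)
  slice-d∈ = InJ-minuend (remainder-slices∈ D d) (Slices∈J′-⊙ quotient∈ g₁ d)

module _ {P : Poly n → Set} where

  Gen-resp : ∀ {f f′} → f ≈ f′ → Gen P f → Gen P f′
  Gen-resp f≈f′ (cs , P-cs , f≈) = cs , P-cs , λ α → trans (sym (f≈f′ α)) (f≈ α)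

  Gen-++ : ∀ {f f′} → Gen P f → Gen P f′ → Gen P (f ++ f′)
  Gen-++ {f} {f′} (cs , P-cs , f≈) (cs′ , P-cs′ , f′≈) = cs ++ cs′ , All.++⁺ P-cs P-cs′ , f++f′≈
    where
    open ≡-Reasoning
    f++f′≈ : (f ++ f′) ≈ linearCombination (cs ++ cs′)
    f++f′≈ α = begin
      coeff (f ++ f′) α
        ≡⟨ coeff-++ f f′ α ⟩
      coeff f α + coeff f′ α
        ≡⟨ cong₂ _+_ (f≈ α) (f′≈ α) ⟩
      coeff (linearCombination cs) α + coeff (linearCombination cs′) α
        ≡⟨ coeff-++ (linearCombination cs) (linearCombination cs′) α ⟨
      coeff (linearCombination cs ++ linearCombination cs′) α
        ≡⟨ cong (λ g → coeff g α) (Listₚ.concat-++ (map _ cs) (map _ cs′)) ⟩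
      coeff (sumP (map _ cs ++ map _ cs′)) α
        ≡⟨ cong (λ g → coeff (sumP g) α) (Listₚ.map-++ _ cs cs′) ⟨
      coeff (linearCombination (cs ++ cs′)) α ∎

  Gen-*P : ∀ q {g} → P g → Gen P (q *P g)
  Gen-*P q {g} Pg =
    [ (q , g) ] , Pg ∷ [] , λ α → sym (cong (λ p → coeff p α) (Listₚ.++-identityʳ (q *P g)))

termMul-identity : (g : Poly n) → termMul 1ℤ 𝟎 g ≡ g
termMul-identity []            = refl
termMul-identity ((c , γ) ∷ g) =
  cong₂ _∷_ (cong₂ _,_ (ℤₚ.*-identityˡ c) (+ᵐ-identityˡ γ)) (termMul-identity g)

Gen-generator : ∀ {P : Poly n → Set} {g} → P g → Gen P g
Gen-generator {g = g} Pg =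
  Gen-resp {f = term 1ℤ 𝟎 *P g} {f′ = g} (λ α → cong (λ p → coeff p α) term1*g≡g) (Gen-*P (term 1ℤ 𝟎) Pg)
  where
  term1*g≡g : term 1ℤ 𝟎 *P g ≡ g
  term1*g≡g = trans (Listₚ.++-identityʳ (termMul 1ℤ 𝟎 g)) (termMul-identity g)

ProductsRewrite : (P P′ : Poly n → Set) → Set
ProductsRewrite {n} P P′ = ∀ q g → P g →
  Σ (Poly n × Poly n) λ r → P′ (proj₂ r) × (coeff (q *P g) ≐ coeff (proj₁ r *P proj₂ r))

Gen-map : ∀ {P P′ : Poly n → Set} → ProductsRewrite P P′ → ∀ f → Gen P f → Gen P′ f
Gen-map {n} {P} {P′} rewrite-product f (cs , P-cs , f≈) =
  Gen-resp {f = linearCombination cs} {f′ = f} (λ α → sym (f≈ α)) (combination∈ cs P-cs)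
  where
  combination∈ : ∀ cs → All (λ c → P (proj₂ c)) cs → Gen P′ (linearCombination cs)
  combination∈ []             []          = [] , [] , λ _ → refl
  combination∈ ((q , g) ∷ cs) (Pg ∷ P-cs) with rewrite-product q g Pg
  ... | (q′ , g′) , P′g′ , q*g≐ =
    Gen-++ {f = q *P g} {f′ = linearCombination cs}
      (Gen-resp {f = q′ *P g′} {f′ = q *P g} (λ α → sym (q*g≐ α)) (Gen-*P q′ P′g′))
      (combination∈ cs P-cs)

PowerOfVariable : (Fin n → ℕ) → Poly n → Set
PowerOfVariable {n} b g = Σ (Fin n) λ i → g ≡ xpow i (b i)

LeadingTermOf : (Poly n → Set) → Poly n → Set
LeadingTermOf {n} I t =
  Σ (Poly n) λ g → I g × Σ ℤ λ c → Σ (Mono n) λ α → IsLeadingTerm g c α × (t ≡ term c α)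

*P-term-split : ∀ (q : Poly n) c {α α′ ε} → α′ +ᵐ ε ≡ α →
  q *P term c α ≡ (q *P term c α′) *P term 1ℤ ε
*P-term-split []            c         eq = refl
*P-term-split ((d , γ) ∷ q) c {α′ = α′} {ε} eq = cong₂ _∷_
  (cong₂ _,_ (sym (ℤₚ.*-identityʳ (d * c))) (trans (cong (γ +ᵐ_) (sym eq)) (sym (+ᵐ-assoc γ α′ ε))))
  (*P-term-split q c eq)

pureExp-split : ∀ (i : Fin n) (α : Mono n) {b} → b ≤ lookup α i →
  (α [ i ]≔ (lookup α i ℕ.∸ b)) +ᵐ pureExp i b ≡ α
pureExp-split fzero    (a ∷ α) b≤a = cong₂ _∷_ (ℕₚ.m∸n+n≡m b≤a) (+ᵐ-identityʳ α)
pureExp-split (fsuc k) (a ∷ α) b≤a = cong₂ _∷_ (ℕₚ.+-identityʳ a) (pureExp-split k α b≤a)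

leadingTerm⇒power : (b : Fin n → ℕ) →
  ProductsRewrite (LeadingTermOf (Gen (Generator b))) (PowerOfVariable b)
leadingTerm⇒power b q _ (g , g∈J , c , α , (gα≡c , c≢0 , g-top) , refl)
  with leadingExponent-divisible b (Gen⇒InJ g g∈J) ((λ gα≡0 → c≢0 (trans (sym gα≡c) gα≡0)) , g-top)
... | i , bᵢ≤αᵢ = (q *P term c (α [ i ]≔ (lookup α i ℕ.∸ b i)) , xpow i (b i)) , (i , refl) ,
                  λ γ → cong (λ p → coeff p γ) (*P-term-split q c (pureExp-split i α bᵢ≤αᵢ))

power⇒leadingTerm : (b : Fin n → ℕ) →
  ProductsRewrite (PowerOfVariable b) (LeadingTermOf (Gen (Generator b)))
power⇒leadingTerm b q _ (i , refl) =
  (q , xpow i (b i)) ,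
  (eTilde (b i) (from i) , Gen-generator (i , refl) , 1ℤ , pureExp i (b i) , eTilde-leadingTerm i (b i) , refl) ,
  λ _ → refl

lemma5p10 : (n : ℕ) (h : Fin n → ℕ) → IsHessenberg n h →
    (f : Poly n) → (LTIdeal (Jh h) f → MonIdealBeta h f) × (MonIdealBeta h f → LTIdeal (Jh h) f)
lemma5p10 n h _ f = Gen-map (leadingTerm⇒power (beta h)) f , Gen-map (power⇒leadingTerm (beta h)) f
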